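{- For any positive integers $k$ and $n$, \[ \binom{n}{f(k)}\le M(n,k), \] where $f(k)$ is the maximum of $\left|\bigcup_{F\in\mathcal{F}}F\right|$ over all intersecting families $\mathcal{F}$ of $k$-element sets with covering number $\tau(\mathcal{F})=k$, and $M(n,k)$ is the number of maximal intersecting families $\mathcal{F}\subseteq\binom{[n]}{k}$.
   Context: A family of sets is intersecting if any two of its members have nonempty intersection. The covering number $\tau(\mathcal{F})$ is the minimum size of a set meeting every member of $\mathcal{F}$ ($f(k)$ is finite). $\binom{[n]}{k}$ is the family of $k$-element subsets of $[n]=\{1,\dots,n\}$; a family $\mathcal{F}\subseteq\binom{[n]}{k}$ is maximal intersecting if it is intersecting and no set of $\binom{[n]}{k}\setminus\mathcal{F}$ can be added to it keeping it intersecting. By convention $\binom{n}{m}=0$ if $m>n$. -}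

module Defs where

open import Data.Nat using (ℕ; zero; suc; _≤_; _≟_)
open import Data.Bool using (Bool; true; false)
import Data.Bool as Bool
open import Data.Product using (Σ; ∃; _×_; _,_)
open import Data.List using (List; []; _∷_; _++_; map; length; filter)
open import Data.List.Relation.Unary.All using (All; all?)
open import Data.List.Membership.Propositional using (_∈_; _∉_)
import Data.Vec.Properties
open import Data.Vec using (Vec; []; _∷_)
open import Data.Fin.Subset using (Subset; _∩_; ∣_∣; ⋃; Nonempty)
open import Data.Fin.Subset.Properties using (nonempty?)
open import Relation.Nullary using (¬_; Dec; ¬?; _×-dec_)
open import Relation.Binary.PropositionalEquality using (_≡_)
open import Relation.Nullary.Decidable using (_→-dec_)

-- A family of subsets of [n] = Fin n is represented by a list of subsets.

subsets : (n : ℕ) → List (Subset n)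
subsets zero = [] ∷ []
subsets (suc n) = map (false ∷_) (subsets n) ++ map (true ∷_) (subsets n)

-- the k-element subsets of [n], i.e. binom([n],k), each listed exactly once
ksets : (n k : ℕ) → List (Subset n)
ksets n k = filter (λ A → ∣ A ∣ ≟ k) (subsets n)

-- all sublists of a list; applied to ksets n k it lists every
-- subfamily of binom([n],k) exactly once
sublists : {A : Set} → List A → List (List A)
sublists [] = [] ∷ []
sublists (x ∷ xs) = map (x ∷_) (sublists xs) ++ sublists xs

Meets : {n : ℕ} → Subset n → Subset n → Set
Meets A B = Nonempty (A ∩ B)

Intersecting : {n : ℕ} → List (Subset n) → Set
Intersecting F = All (λ A → All (λ B → Meets A B) F) F

IsCover : {n : ℕ} → Subset n → List (Subset n) → Set
IsCover T F = All (λ A → Meets T A) F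

CoveringNumber : {n : ℕ} → List (Subset n) → ℕ → Set
CoveringNumber {n} F t =
  (Σ (Subset n) λ T → IsCover T F × ∣ T ∣ ≡ t) ×
  ((T : Subset n) → IsCover T F → t ≤ ∣ T ∣)

Uniform : {n : ℕ} → ℕ → List (Subset n) → Set
Uniform k F = All (λ A → ∣ A ∣ ≡ k) F

Admissible : {m : ℕ} → ℕ → List (Subset m) → Set
Admissible k F = Uniform k F × Intersecting F × CoveringNumber F k

-- d = f(k): d is the maximum of |⋃ F| over admissible families
-- (on any finite ground set [m])
IsF : ℕ → ℕ → Set
IsF k d =
  (Σ ℕ λ m → Σ (List (Subset m)) λ F → Admissible k F × ∣ ⋃ F ∣ ≡ d) ×
  ((m : ℕ) (F : List (Subset m)) → Admissible k F → ∣ ⋃ F ∣ ≤ d)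

MaximalIntersecting : (n k : ℕ) → List (Subset n) → Set
MaximalIntersecting n k F =
  Intersecting F × All (λ A → A ∉ F → ¬ Intersecting (A ∷ F)) (ksets n k)

meets? : {n : ℕ} (A B : Subset n) → Dec (Meets A B)
meets? A B = nonempty? (A ∩ B)

intersecting? : {n : ℕ} (F : List (Subset n)) → Dec (Intersecting F)
intersecting? F = all? (λ A → all? (λ B → meets? A B) F) F

maximalIntersecting? : (n k : ℕ) (F : List (Subset n)) → Dec (MaximalIntersecting n k F)
maximalIntersecting? n k F =
  intersecting? F ×-dec
  all? (λ A → ¬? (A ∈L? F) →-dec ¬? (intersecting? (A ∷ F))) (ksets n k)
  where
  open import Data.List.Membership.DecPropositional
    (Data.Vec.Properties.≡-dec {n = n} Bool._≟_) using () renaming (_∈?_ to _∈L?_)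

M : ℕ → ℕ → ℕ
M n k = length (filter (maximalIntersecting? n k) (sublists (ksets n k)))

module Submission where

-- Let G be an intersecting family of k-sets on [m] with
-- τ(G) = k whose union U has the extremal size d = f(k), and let S be any
-- d-subset of [n].  Relabelling U onto S by the increasing bijection gives
-- an intersecting family G_S of k-sets with ⋃ G_S = S, and every cover T of
-- G_S pulls back to a cover of G of size at most |T|, so covers of G_S have
-- at least k elements.  Extend G_S greedily to a maximal intersecting family
-- F ⊆ binom([n],k).  A member of F covers F and a cover of F covers G_S, so
-- τ(F) = k; by the extremality of d, |⋃ F| ≤ d = |S|, and S ⊆ ⋃ F, hence
-- ⋃ F = S.  So every d-subset of [n] is the union of one of the M(n,k)
-- maximal intersecting families, and a pigeonhole count gives the bound.

open import Data.Nat using (ℕ; zero; suc; _≤_; _+_; z≤n; s≤s; _≟_)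
open import Data.Nat.Properties using (module ≤-Reasoning; ≤-trans; ≤-reflexive; ≤⇒≯; m≤n⇒m≤1+n; +-comm; +-identityʳ; suc-injective)
open import Data.Nat.Combinatorics using (_C_; nCk+nC[k+1]≡[n+1]C[k+1])
open import Data.Bool using (true; false)
import Data.Bool as Bool
open import Data.Vec using ([]; _∷_)
import Data.Vec.Base as Vec
open import Data.Vec.Properties using (∷-injectiveʳ)
import Data.Vec.Properties
open import Data.Fin using (zero; suc)
open import Data.Fin.Subset using (Subset; _∪_; ∣_∣; ⋃; ⊥; Nonempty; _⊆_)
open import Data.Fin.Subset.Properties
  using (∩-comm; drop-∷-⊆; ⊆-antisym; _∈?_; p⊂q⇒∣p∣<∣q∣; ∉⊥; x∈p∪q⁻; x∈p∪q⁺; ∣⊥∣≡0)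
open import Data.List using (List; []; _∷_; _++_; map; filter; length; removeAt)
open import Data.List.Properties using (length-map; length-++; filter-++; filter-≐; filter-none; length-removeAt′)
open import Data.List.Membership.Propositional using (_∈_; _∉_)
open import Data.List.Membership.Propositional.Properties
  using (∈-map⁺; ∈-map⁻; ∈-++⁺ˡ; ∈-++⁺ʳ; ∈-filter⁺; ∈-filter⁻)
import Data.List.Membership.DecPropositional as DecMembership
open import Data.List.Relation.Binary.Subset.Propositional using () renaming (_⊆_ to _⊆ᴸ_)
open import Data.List.Relation.Binary.Subset.Propositional.Properties using (∷⁺ʳ)
open import Data.List.Relation.Unary.Any using (here; there; index)
open import Data.List.Relation.Unary.All using ([]; lookup; tabulate)
import Data.List.Relation.Unary.All as All
open import Data.List.Relation.Unary.All.Properties using (anti-mono; map⁺; map⁻)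
open import Data.List.Relation.Unary.Unique.Propositional using (Unique)
import Data.List.Relation.Unary.Unique.Propositional.Properties as Unique
open import Data.List.Relation.Unary.AllPairs using ([]; _∷_)
open import Data.Product using (∃; _×_; _,_; proj₁; proj₂)
open import Data.Sum using (_⊎_; inj₁; inj₂)
import Data.Sum as Sum
open import Function using (_∘_; id)
open import Relation.Nullary using (¬_; Dec; yes; no; does; contradiction)
open import Relation.Unary using (Decidable)
open import Relation.Binary.PropositionalEquality
  using (_≡_; _≢_; refl; sym; trans; cong; cong₂; subst; ≢-sym; module ≡-Reasoning)
open import Defs

private
  variable
    m n k d : ℕ

meets-sym : {A B : Subset n} → Meets A B → Meets B A
meets-sym {A = A} {B} = subst Nonempty (∩-comm A B)

meets-∷⁺ : ∀ {x y} {A B : Subset n} →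
  (x ≡ true × y ≡ true) ⊎ Meets A B → Meets (x ∷ A) (y ∷ B)
meets-∷⁺ (inj₁ (refl , refl)) = zero , Vec.here
meets-∷⁺ (inj₂ (i , i∈A∩B))  = suc i , Vec.there i∈A∩B

meets-∷⁻ : ∀ {x y} {A B : Subset n} →
  Meets (x ∷ A) (y ∷ B) → (x ≡ true × y ≡ true) ⊎ Meets A B
meets-∷⁻ {x = true}  {true}  _                   = inj₁ (refl , refl)
meets-∷⁻ {x = false}         (zero , ())
meets-∷⁻ {x = true}  {false} (zero , ())
meets-∷⁻                     (suc i , Vec.there p) = inj₂ (i , p)

meets-false∷ : ∀ {y} {A B : Subset n} → Meets (false ∷ A) (y ∷ B) → Meets A B
meets-false∷ (suc i , Vec.there p) = i , p

meets-[] : ¬ Meets {0} [] []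
meets-[] (() , _)

-- restrict U A is the trace of A on U, read in increasing order as a
-- subset of [|U|].
restrict : (U : Subset m) → Subset m → Subset ∣ U ∣
restrict []          []      = []
restrict (true ∷ U)  (x ∷ A) = x ∷ restrict U A
restrict (false ∷ U) (x ∷ A) = restrict U A

-- expand S l is the image of l ⊆ [|S|] under the increasing bijection
-- [|S|] → S.
expand : (S : Subset n) → Subset ∣ S ∣ → Subset n
expand []          []      = []
expand (true ∷ S)  (x ∷ l) = x ∷ expand S l
expand (false ∷ S) l       = false ∷ expand S l

expand-meets⁻ : (S : Subset n) (l : Subset ∣ S ∣) (T : Subset n) →
  Meets (expand S l) T → Meets l (restrict S T)
expand-meets⁻ []          []      []      p = contradiction p meets-[]
expand-meets⁻ (true ∷ S)  (x ∷ l) (y ∷ T) =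
  meets-∷⁺ {x = x} {y} ∘ Sum.map₂ (expand-meets⁻ S l T) ∘ meets-∷⁻ {x = x} {y}
expand-meets⁻ (false ∷ S) l       (y ∷ T) = expand-meets⁻ S l T ∘ meets-false∷ {y = y}

expand-meets⁺ : (S : Subset n) (l : Subset ∣ S ∣) (T : Subset n) →
  Meets l (restrict S T) → Meets (expand S l) T
expand-meets⁺ []          []      []      p = contradiction p meets-[]
expand-meets⁺ (true ∷ S)  (x ∷ l) (y ∷ T) =
  meets-∷⁺ {x = x} {y} ∘ Sum.map₂ (expand-meets⁺ S l T) ∘ meets-∷⁻ {x = x} {y}
expand-meets⁺ (false ∷ S) l       (y ∷ T) = meets-∷⁺ {x = false} {y} ∘ inj₂ ∘ expand-meets⁺ S l T

restrict-expand : (S : Subset n) (l : Subset ∣ S ∣) → restrict S (expand S l) ≡ l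
restrict-expand []          []      = refl
restrict-expand (true ∷ S)  (x ∷ l) = cong (x ∷_) (restrict-expand S l)
restrict-expand (false ∷ S) l       = restrict-expand S l

expand-restrict : (S A : Subset n) → A ⊆ S → expand S (restrict S A) ≡ A
expand-restrict []          []          _   = refl
expand-restrict (true ∷ S)  (x ∷ A)     A⊆S = cong (x ∷_) (expand-restrict S A (drop-∷-⊆ A⊆S))
expand-restrict (false ∷ S) (false ∷ A) A⊆S = cong (false ∷_) (expand-restrict S A (drop-∷-⊆ A⊆S))
expand-restrict (false ∷ S) (true ∷ A)  A⊆S = contradiction (A⊆S Vec.here) λ ()

expand-⊆ : (S : Subset n) (l : Subset ∣ S ∣) → expand S l ⊆ S
expand-⊆ (true ∷ S)  (x ∷ l) Vec.here      = Vec.here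
expand-⊆ (true ∷ S)  (x ∷ l) (Vec.there p) = Vec.there (expand-⊆ S l p)
expand-⊆ (false ∷ S) l       (Vec.there p) = Vec.there (expand-⊆ S l p)

∣expand∣ : (S : Subset n) (l : Subset ∣ S ∣) → ∣ expand S l ∣ ≡ ∣ l ∣
∣expand∣ []          []          = refl
∣expand∣ (true ∷ S)  (true ∷ l)  = cong suc (∣expand∣ S l)
∣expand∣ (true ∷ S)  (false ∷ l) = ∣expand∣ S l
∣expand∣ (false ∷ S) l           = ∣expand∣ S l

∣restrict∣≤ : (U A : Subset m) → ∣ restrict U A ∣ ≤ ∣ A ∣
∣restrict∣≤ []          []          = z≤n
∣restrict∣≤ (true ∷ U)  (true ∷ A)  = s≤s (∣restrict∣≤ U A)
∣restrict∣≤ (true ∷ U)  (false ∷ A) = ∣restrict∣≤ U A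
∣restrict∣≤ (false ∷ U) (true ∷ A)  = m≤n⇒m≤1+n (∣restrict∣≤ U A)
∣restrict∣≤ (false ∷ U) (false ∷ A) = ∣restrict∣≤ U A

expand-∪ : (S : Subset n) (l l′ : Subset ∣ S ∣) → expand S (l ∪ l′) ≡ expand S l ∪ expand S l′
expand-∪ []          []      []        = refl
expand-∪ (true ∷ S)  (x ∷ l) (x′ ∷ l′) = cong (_ ∷_) (expand-∪ S l l′)
expand-∪ (false ∷ S) l       l′        = cong (false ∷_) (expand-∪ S l l′)

expand-⊥ : (S : Subset n) → expand S ⊥ ≡ ⊥
expand-⊥ []          = refl
expand-⊥ (true ∷ S)  = cong (false ∷_) (expand-⊥ S)
expand-⊥ (false ∷ S) = cong (false ∷_) (expand-⊥ S)

restrict-∪ : (U A B : Subset m) → restrict U (A ∪ B) ≡ restrict U A ∪ restrict U B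
restrict-∪ []          []      []      = refl
restrict-∪ (true ∷ U)  (x ∷ A) (y ∷ B) = cong (_ ∷_) (restrict-∪ U A B)
restrict-∪ (false ∷ U) (x ∷ A) (y ∷ B) = restrict-∪ U A B

restrict-⊥ : (U : Subset m) → restrict U ⊥ ≡ ⊥
restrict-⊥ []          = refl
restrict-⊥ (true ∷ U)  = cong (false ∷_) (restrict-⊥ U)
restrict-⊥ (false ∷ U) = restrict-⊥ U

module _ {a b : ℕ} where

  subst-meets : (e : a ≡ b) {X Y : Subset a} →
    Meets X Y → Meets (subst Subset e X) (subst Subset e Y)
  subst-meets refl = id

  subst-meets-sym : (e : a ≡ b) {X : Subset a} {Y : Subset b} →
    Meets (subst Subset e X) Y → Meets X (subst Subset (sym e) Y)
  subst-meets-sym refl = id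

  ∣subst∣ : (e : a ≡ b) (X : Subset a) → ∣ subst Subset e X ∣ ≡ ∣ X ∣
  ∣subst∣ refl X = refl

  subst-∪ : (e : a ≡ b) (X Y : Subset a) →
    subst Subset e (X ∪ Y) ≡ subst Subset e X ∪ subst Subset e Y
  subst-∪ refl X Y = refl

  subst-⊥ : (e : a ≡ b) → subst Subset e ⊥ ≡ ⊥
  subst-⊥ refl = refl

⊆-card-eq : {A B : Subset n} → A ⊆ B → ∣ B ∣ ≤ ∣ A ∣ → A ≡ B
⊆-card-eq {A = A} {B} A⊆B ∣B∣≤∣A∣ = ⊆-antisym A⊆B B⊆A
  where
  B⊆A : B ⊆ A
  B⊆A {x} x∈B with x ∈? A
  ... | yes x∈A = x∈A
  ... | no  x∉A = contradiction (p⊂q⇒∣p∣<∣q∣ (A⊆B , x , x∈B , x∉A)) (≤⇒≯ ∣B∣≤∣A∣)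

⊆-⋃ : {A : Subset n} {G : List (Subset n)} → A ∈ G → A ⊆ ⋃ G
⊆-⋃ {G = B ∷ G} (here refl) = x∈p∪q⁺ ∘ inj₁
⊆-⋃ {G = B ∷ G} (there A∈G) = x∈p∪q⁺ ∘ inj₂ ∘ ⊆-⋃ A∈G

⋃-mono : {G H : List (Subset n)} → G ⊆ᴸ H → ⋃ G ⊆ ⋃ H
⋃-mono {G = []}    _   x∈⋃G = contradiction x∈⋃G ∉⊥
⋃-mono {G = A ∷ G} G⊆H x∈⋃G with x∈p∪q⁻ A (⋃ G) x∈⋃G
... | inj₁ x∈A  = ⊆-⋃ (G⊆H (here refl)) x∈A
... | inj₂ x∈⋃G′ = ⋃-mono (G⊆H ∘ there) x∈⋃G′

-- Relabelling along the increasing bijection between two sets of equal size.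
module Transport (U : Subset m) (S : Subset n) (same : ∣ U ∣ ≡ ∣ S ∣) where

  -- carries the part of a set inside U to the corresponding part of S
  transport : Subset m → Subset n
  transport A = expand S (subst Subset same (restrict U A))

  pullback : Subset n → Subset m
  pullback T = expand U (subst Subset (sym same) (restrict S T))

  transport-meets : {A B : Subset m} → A ⊆ U → Meets A B → Meets (transport A) (transport B)
  transport-meets {A} {B} A⊆U A∩B =
    expand-meets⁺ S _ (transport B)
      (subst (Meets _) (sym (restrict-expand S _))
        (subst-meets same
          (expand-meets⁻ U (restrict U A) B
            (subst (λ X → Meets X B) (sym (expand-restrict U A A⊆U)) A∩B))))

  pullback-meets : {A : Subset m} {T : Subset n} → Meets T (transport A) → Meets (pullback T) A
  pullback-meets {A} {T} T∩A =
    expand-meets⁺ U _ A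
      (meets-sym (subst-meets-sym same (expand-meets⁻ S _ T (meets-sym T∩A))))

  ∣transport∣ : {A : Subset m} → A ⊆ U → ∣ transport A ∣ ≡ ∣ A ∣
  ∣transport∣ {A} A⊆U = begin
    ∣ transport A ∣                        ≡⟨ ∣expand∣ S _ ⟩
    ∣ subst Subset same (restrict U A) ∣   ≡⟨ ∣subst∣ same _ ⟩
    ∣ restrict U A ∣                       ≡⟨ ∣expand∣ U _ ⟨
    ∣ expand U (restrict U A) ∣            ≡⟨ cong ∣_∣ (expand-restrict U A A⊆U) ⟩
    ∣ A ∣                                  ∎
    where open ≡-Reasoning

  ∣pullback∣≤ : (T : Subset n) → ∣ pullback T ∣ ≤ ∣ T ∣
  ∣pullback∣≤ T = subst (_≤ ∣ T ∣) (sym (trans (∣expand∣ U _) (∣subst∣ (sym same) _))) (∣restrict∣≤ S T)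

  transport-⋃ : (L : List (Subset m)) → transport (⋃ L) ≡ ⋃ (map transport L)
  transport-⋃ [] = begin
    expand S (subst Subset same (restrict U ⊥)) ≡⟨ cong (expand S ∘ subst Subset same) (restrict-⊥ U) ⟩
    expand S (subst Subset same ⊥)              ≡⟨ cong (expand S) (subst-⊥ same) ⟩
    expand S ⊥                                  ≡⟨ expand-⊥ S ⟩
    ⊥                                           ∎
    where open ≡-Reasoning
  transport-⋃ (A ∷ L) = begin
    expand S (subst Subset same (restrict U (A ∪ ⋃ L)))
      ≡⟨ cong (expand S ∘ subst Subset same) (restrict-∪ U A (⋃ L)) ⟩
    expand S (subst Subset same (restrict U A ∪ restrict U (⋃ L)))
      ≡⟨ cong (expand S) (subst-∪ same _ _) ⟩
    expand S (subst Subset same (restrict U A) ∪ subst Subset same (restrict U (⋃ L)))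
      ≡⟨ expand-∪ S _ _ ⟩
    transport A ∪ transport (⋃ L)
      ≡⟨ cong (transport A ∪_) (transport-⋃ L) ⟩
    transport A ∪ ⋃ (map transport L)
      ∎
    where open ≡-Reasoning

  transport-whole : transport U ≡ S
  transport-whole = ⊆-card-eq (expand-⊆ S _)
    (≤-reflexive (trans (sym same) (sym (∣transport∣ id))))

intersecting-⊆ : {F G : List (Subset n)} → F ⊆ᴸ G → Intersecting G → Intersecting F
intersecting-⊆ F⊆G = anti-mono F⊆G ∘ All.map (anti-mono F⊆G)

intersecting-map : {G : List (Subset m)} (f : Subset m → Subset n) →
  (∀ {A B} → A ∈ G → Meets A B → Meets (f A) (f B)) →
  Intersecting G → Intersecting (map f G)
intersecting-map f preserves G-int =
  map⁺ (tabulate λ A∈G → map⁺ (All.map (preserves A∈G) (lookup G-int A∈G)))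

greedy : List (Subset n) → List (Subset n) → List (Subset n)
greedy F []       = F
greedy F (A ∷ As) with intersecting? (A ∷ F)
... | yes _ = greedy (A ∷ F) As
... | no  _ = greedy F As

greedy-intersecting : (F As : List (Subset n)) → Intersecting F → Intersecting (greedy F As)
greedy-intersecting F []       F-int = F-int
greedy-intersecting F (A ∷ As) F-int with intersecting? (A ∷ F)
... | yes AF-int = greedy-intersecting (A ∷ F) As AF-int
... | no  _      = greedy-intersecting F As F-int

greedy-⊇ : (F As : List (Subset n)) → F ⊆ᴸ greedy F As
greedy-⊇ F []       = id
greedy-⊇ F (A ∷ As) with intersecting? (A ∷ F)
... | yes _ = greedy-⊇ (A ∷ F) As ∘ there
... | no  _ = greedy-⊇ F As

greedy-⊆ : (F As : List (Subset n)) {B : Subset n} → B ∈ greedy F As → B ∈ F ⊎ B ∈ As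
greedy-⊆ F []       B∈ = inj₁ B∈
greedy-⊆ F (A ∷ As) B∈ with intersecting? (A ∷ F)
... | no  _ = Sum.map₂ there (greedy-⊆ F As B∈)
... | yes _ with greedy-⊆ (A ∷ F) As B∈
...   | inj₁ (here refl) = inj₂ (here refl)
...   | inj₁ (there B∈F) = inj₁ B∈F
...   | inj₂ B∈As        = inj₂ (there B∈As)

greedy-maximal : (F As : List (Subset n)) {A : Subset n} → A ∈ As →
  A ∉ greedy F As → ¬ Intersecting (A ∷ greedy F As)
greedy-maximal F (B ∷ As) A∈As A∉ A-int with intersecting? (B ∷ F) | A∈As
... | yes _   | here refl = A∉ (greedy-⊇ (B ∷ F) As (here refl))
... | yes _   | there A∈ = greedy-maximal (B ∷ F) As A∈ A∉ A-int
... | no ¬int | here refl = ¬int (intersecting-⊆ (∷⁺ʳ B (greedy-⊇ F As)) A-int)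
... | no _    | there A∈ = greedy-maximal F As A∈ A∉ A-int

subsets-complete : (A : Subset n) → A ∈ subsets n
subsets-complete {zero}  []          = here refl
subsets-complete {suc n} (false ∷ A) = ∈-++⁺ˡ (∈-map⁺ (false ∷_) (subsets-complete A))
subsets-complete {suc n} (true ∷ A)  =
  ∈-++⁺ʳ (map (false ∷_) (subsets n)) (∈-map⁺ (true ∷_) (subsets-complete A))

subsets-unique : (n : ℕ) → Unique (subsets n)
subsets-unique zero    = [] ∷ []
subsets-unique (suc n) =
  Unique.++⁺ (Unique.map⁺ ∷-injectiveʳ (subsets-unique n))
             (Unique.map⁺ ∷-injectiveʳ (subsets-unique n))
             disjoint
  where
  disjoint : ∀ {A} → ¬ (A ∈ map (false ∷_) (subsets n) × A ∈ map (true ∷_) (subsets n))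
  disjoint (A∈₀ , A∈₁) with ∈-map⁻ (false ∷_) A∈₀ | ∈-map⁻ (true ∷_) A∈₁
  ... | _ , _ , refl | _ , _ , ()

∈-ksets : {A : Subset n} → ∣ A ∣ ≡ k → A ∈ ksets n k
∈-ksets {k = k} {A} ∣A∣≡k = ∈-filter⁺ (λ A → ∣ A ∣ ≟ k) (subsets-complete A) ∣A∣≡k

ksets-size : {A : Subset n} → A ∈ ksets n k → ∣ A ∣ ≡ k
ksets-size {n} {k} A∈ = proj₂ (∈-filter⁻ (λ A → ∣ A ∣ ≟ k) {xs = subsets n} A∈)

ksets-unique : (n k : ℕ) → Unique (ksets n k)
ksets-unique n k = Unique.filter⁺ (λ A → ∣ A ∣ ≟ k) (subsets-unique n)

filter-map : {A B : Set} {P : B → Set} (P? : Decidable P) (f : A → B) (xs : List A) →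
  filter P? (map f xs) ≡ map f (filter (P? ∘ f) xs)
filter-map P? f []       = refl
filter-map P? f (x ∷ xs) with does (P? (f x))
... | true  = cong (f x ∷_) (filter-map P? f xs)
... | false = filter-map P? f xs

-- Splitting the d-subsets of [n+1] according to whether they contain 0.
length-ksets-suc : (n d : ℕ) →
  length (ksets (suc n) d) ≡ length (ksets n d) + length (filter (λ A → suc ∣ A ∣ ≟ d) (subsets n))
length-ksets-suc n d = begin
  length (filter P? (map (false ∷_) (subsets n) ++ map (true ∷_) (subsets n)))
    ≡⟨ cong length (filter-++ P? (map (false ∷_) (subsets n)) _) ⟩
  length (filter P? (map (false ∷_) (subsets n)) ++ filter P? (map (true ∷_) (subsets n)))
    ≡⟨ length-++ (filter P? (map (false ∷_) (subsets n))) ⟩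
  length (filter P? (map (false ∷_) (subsets n))) + length (filter P? (map (true ∷_) (subsets n)))
    ≡⟨ cong₂ _+_ (cong length (filter-map P? (false ∷_) (subsets n)))
                 (cong length (filter-map P? (true ∷_) (subsets n))) ⟩
  length (map (false ∷_) (ksets n d)) + length (map (true ∷_) (filter (λ A → suc ∣ A ∣ ≟ d) (subsets n)))
    ≡⟨ cong₂ _+_ (length-map (false ∷_) (ksets n d))
                 (length-map (true ∷_) (filter (λ A → suc ∣ A ∣ ≟ d) (subsets n))) ⟩
  length (ksets n d) + length (filter (λ A → suc ∣ A ∣ ≟ d) (subsets n))
    ∎
  where
  open ≡-Reasoning
  P? : (A : Subset (suc n)) → Dec (∣ A ∣ ≡ d)
  P? A = ∣ A ∣ ≟ d

length-ksets : (n d : ℕ) → length (ksets n d) ≡ n C d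
length-ksets zero    zero    = refl
length-ksets zero    (suc d) = refl
length-ksets (suc n) zero    = begin
  length (ksets (suc n) 0)                                   ≡⟨ length-ksets-suc n 0 ⟩
  length (ksets n 0) + length (filter (λ A → suc ∣ A ∣ ≟ 0) (subsets n))
    ≡⟨ cong₂ _+_ (length-ksets n 0) (cong length (filter-none (λ A → suc ∣ A ∣ ≟ 0) {xs = subsets n} (All.universal (λ _ ()) (subsets n)))) ⟩
  n C 0 + 0                                                  ≡⟨ +-identityʳ (n C 0) ⟩
  suc n C 0                                                  ∎
  where open ≡-Reasoning
length-ksets (suc n) (suc d) = begin
  length (ksets (suc n) (suc d))
    ≡⟨ length-ksets-suc n (suc d) ⟩
  length (ksets n (suc d)) + length (filter (λ A → suc ∣ A ∣ ≟ suc d) (subsets n))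
    ≡⟨ cong (length (ksets n (suc d)) +_) (cong length (filter-≐ _ _ (suc-injective , cong suc) (subsets n))) ⟩
  length (ksets n (suc d)) + length (ksets n d)
    ≡⟨ cong₂ _+_ (length-ksets n (suc d)) (length-ksets n d) ⟩
  n C suc d + n C d
    ≡⟨ +-comm (n C suc d) (n C d) ⟩
  n C d + n C suc d
    ≡⟨ nCk+nC[k+1]≡[n+1]C[k+1] n d ⟩
  suc n C suc d
    ∎
  where open ≡-Reasoning

filter-∈-sublists : {A : Set} {P : A → Set} (P? : Decidable P) (xs : List A) →
  filter P? xs ∈ sublists xs
filter-∈-sublists P? []       = here refl
filter-∈-sublists P? (x ∷ xs) with does (P? x)
... | true  = ∈-++⁺ˡ (∈-map⁺ (x ∷_) (filter-∈-sublists P? xs))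
... | false = ∈-++⁺ʳ (map (x ∷_) (sublists xs)) (filter-∈-sublists P? xs)

∈-removeAt : {A : Set} {x z : A} {ys : List A} (x∈ys : x ∈ ys) →
  z ∈ ys → z ≢ x → z ∈ removeAt ys (index x∈ys)
∈-removeAt (here refl)  (here refl)  z≢x = contradiction refl z≢x
∈-removeAt (here refl)  (there z∈ys) _   = z∈ys
∈-removeAt (there x∈ys) (here refl)  _   = here refl
∈-removeAt (there x∈ys) (there z∈ys) z≢x = there (∈-removeAt x∈ys z∈ys z≢x)

unique-⊆⇒length≤ : {A : Set} {xs ys : List A} → Unique xs → xs ⊆ᴸ ys → length xs ≤ length ys
unique-⊆⇒length≤ {xs = []}     _               _     = z≤n
unique-⊆⇒length≤ {xs = x ∷ xs} {ys} (x∉xs ∷ xs-uniq) xs⊆ys =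
  subst (suc (length xs) ≤_) (sym (length-removeAt′ ys (index x∈ys)))
    (s≤s (unique-⊆⇒length≤ xs-uniq
      (λ z∈xs → ∈-removeAt x∈ys (xs⊆ys (there z∈xs)) (≢-sym (lookup x∉xs z∈xs)))))
  where
  x∈ys : x ∈ ys
  x∈ys = xs⊆ys (here refl)

_∈ᴸ?_ : (A : Subset n) (F : List (Subset n)) → Dec (A ∈ F)
_∈ᴸ?_ {n} = DecMembership._∈?_ (Data.Vec.Properties.≡-dec {n = n} Bool._≟_)

record MaximalExtension (n k : ℕ) (H : List (Subset n)) : Set where
  field
    family   : List (Subset n)
    listed   : family ∈ sublists (ksets n k)
    maximal  : MaximalIntersecting n k family
    uniform  : Uniform k family
    extends  : H ⊆ᴸ family

-- Every intersecting family of k-subsets of [n] has a maximal intersecting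
-- extension: extend greedily, then list the result in the order of ksets n k.
extendToMaximal : {H : List (Subset n)} → H ⊆ᴸ ksets n k → Intersecting H → MaximalExtension n k H
extendToMaximal {n} {k} {H} H⊆K H-int = record
  { family  = F
  ; listed  = filter-∈-sublists (_∈ᴸ? E) K
  ; maximal = intersecting-⊆ F⊆E E-int , tabulate cannot-add
  ; uniform = tabulate (ksets-size ∘ proj₁ ∘ ∈-filter⁻ (_∈ᴸ? E) {xs = K})
  ; extends = E⊆F ∘ greedy-⊇ H K
  }
  where
  K E F : List (Subset n)
  K = ksets n k
  E = greedy H K
  F = filter (_∈ᴸ? E) K

  E-int : Intersecting E
  E-int = greedy-intersecting H K H-int

  F⊆E : F ⊆ᴸ E
  F⊆E A∈F = proj₂ (∈-filter⁻ (_∈ᴸ? E) {xs = K} A∈F)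

  E⊆F : E ⊆ᴸ F
  E⊆F {A} A∈E = ∈-filter⁺ (_∈ᴸ? E) {xs = K} (Sum.[ H⊆K , id ] (greedy-⊆ H K A∈E)) A∈E

  cannot-add : {A : Subset n} → A ∈ K → A ∉ F → ¬ Intersecting (A ∷ F)
  cannot-add A∈K A∉F AF-int =
    greedy-maximal H K A∈K (A∉F ∘ E⊆F) (intersecting-⊆ (∷⁺ʳ _ E⊆F) AF-int)

-- An admissible family with k ≥ 1 is nonempty, since ⊥ covers the empty family.
admissible-member : 1 ≤ k → {G : List (Subset m)} → Admissible k G → ∃ λ A → A ∈ G
admissible-member {m = m} 1≤k {[]} (_ , _ , _ , covers-large) =
  contradiction (≤-trans 1≤k (≤-trans (covers-large ⊥ []) (≤-reflexive (∣⊥∣≡0 m)))) λ ()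
admissible-member _ {A ∷ G} _ = A , here refl

-- A k-uniform intersecting family F has covering number k if it has a member
-- (which covers F and has size k) and contains a subfamily H all of whose
-- covers have at least k elements (every cover of F covers H).
coveringNumber-k : {F H : List (Subset n)} {A : Subset n} →
  Uniform k F → Intersecting F → A ∈ F → H ⊆ᴸ F →
  ((T : Subset n) → IsCover T H → k ≤ ∣ T ∣) → CoveringNumber F k
coveringNumber-k F-unif F-int A∈F H⊆F covers-large =
  (_ , lookup F-int A∈F , lookup F-unif A∈F) ,
  λ T T-covers → covers-large T (anti-mono H⊆F T-covers)

module TransportedFamily {G : List (Subset m)} (G-adm : Admissible k G)
                         (S : Subset n) (sizes : ∣ ⋃ G ∣ ≡ ∣ S ∣) where
  open Transport (⋃ G) S sizes public

  G-int : Intersecting G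
  G-int = proj₁ (proj₂ G-adm)

  G-covers-large : (T : Subset m) → IsCover T G → k ≤ ∣ T ∣
  G-covers-large = proj₂ (proj₂ (proj₂ G-adm))

  G_S : List (Subset n)
  G_S = map transport G

  G_S-⊆-ksets : G_S ⊆ᴸ ksets n k
  G_S-⊆-ksets A∈ with ∈-map⁻ transport A∈
  ... | A , A∈G , refl = ∈-ksets (trans (∣transport∣ (⊆-⋃ A∈G)) (lookup (proj₁ G-adm) A∈G))

  G_S-int : Intersecting G_S
  G_S-int = intersecting-map transport (λ A∈G → transport-meets (⊆-⋃ A∈G)) G-int

  -- a cover of G_S pulls back to a cover of G which is no larger
  G_S-covers-large : (T : Subset n) → IsCover T G_S → k ≤ ∣ T ∣
  G_S-covers-large T T-covers =
    ≤-trans (G-covers-large (pullback T) (All.map pullback-meets (map⁻ T-covers))) (∣pullback∣≤ T)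

  G_S-union : ⋃ G_S ≡ S
  G_S-union = trans (sym (transport-⋃ G)) transport-whole

record AdmissibleMaximalAround (n k : ℕ) (S : Subset n) : Set where
  field
    family     : List (Subset n)
    listed     : family ∈ sublists (ksets n k)
    maximal    : MaximalIntersecting n k family
    admissible : Admissible k family
    around     : S ⊆ ⋃ family

-- Such a family exists whenever some admissible family has a union of size |S|:
-- relabel it onto S and extend it to a maximal intersecting family.
admissibleMaximalAround : 1 ≤ k → {G : List (Subset m)} → Admissible k G →
  (S : Subset n) → ∣ ⋃ G ∣ ≡ ∣ S ∣ → AdmissibleMaximalAround n k S
admissibleMaximalAround 1≤k {G} G-adm S sizes = record
  { family     = family
  ; listed     = listed
  ; maximal    = maximal
  ; admissible = uniform , proj₁ maximal ,
                 coveringNumber-k uniform (proj₁ maximal) (extends (∈-map⁺ transport A∈G))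
                                  extends G_S-covers-large
  ; around     = subst (_⊆ ⋃ family) G_S-union (⋃-mono extends)
  }
  where
  open TransportedFamily G-adm S sizes
  open MaximalExtension (extendToMaximal G_S-⊆-ksets G_S-int)
  A∈G : proj₁ (admissible-member 1≤k G-adm) ∈ G
  A∈G = proj₂ (admissible-member 1≤k G-adm)

maximalFamilies : (n k : ℕ) → List (List (Subset n))
maximalFamilies n k = filter (maximalIntersecting? n k) (sublists (ksets n k))

-- For d = f(k), each d-subset of [n] is the union of a maximal intersecting
-- family: the family constructed above is admissible, so its union has at
-- most d elements, and it contains S.
dsets-are-unions : 1 ≤ k → IsF k d → ksets n d ⊆ᴸ map ⋃ (maximalFamilies n k)
dsets-are-unions {k} {d} {n} 1≤k ((_ , _ , G-adm , ∣⋃G∣≡d) , extremal) {S} S∈ =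
  subst (_∈ map ⋃ (maximalFamilies n k)) (sym S≡⋃F)
    (∈-map⁺ ⋃ (∈-filter⁺ (maximalIntersecting? n k) listed maximal))
  where
  ∣S∣≡d : ∣ S ∣ ≡ d
  ∣S∣≡d = ksets-size S∈
  open AdmissibleMaximalAround (admissibleMaximalAround 1≤k G-adm S (trans ∣⋃G∣≡d (sym ∣S∣≡d)))
  S≡⋃F : S ≡ ⋃ family
  S≡⋃F = ⊆-card-eq around (≤-trans (extremal n family admissible) (≤-reflexive (sym ∣S∣≡d)))

mainTheorem3 : (k n : ℕ) → 1 ≤ k → 1 ≤ n →
    (d : ℕ) → IsF k d → n C d ≤ M n k
mainTheorem3 k n 1≤k _ d d-is-f = begin
  n C d                                ≡⟨ length-ksets n d ⟨
  length (ksets n d)                   ≤⟨ unique-⊆⇒length≤ (ksets-unique n d) (dsets-are-unions 1≤k d-is-f) ⟩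
  length (map ⋃ (maximalFamilies n k)) ≡⟨ length-map ⋃ (maximalFamilies n k) ⟩
  M n k                                ∎
  where open ≤-Reasoning
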